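{- For every integer $n \ge 2$, $x(n) = f(n)$.
   Context: Work in the square grid: cells are unit squares with integer corners, and two cells are neighbors if they share an edge. The $n\times n$ board is an $n \times n$ square of cells. An X-pentomino is a set consisting of a cell together with its four neighbors. $x(n)$ is the minimum number of X-pentominoes (placed in the grid) whose union contains the $n\times n$ board; they may overlap each other and may contain cells outside the board. A fragment is a cell $c$ together with a nonempty subset of its four neighbors. $f(n)$ is the minimum number of fragments in a partition of the $n \times n$ board into fragments each contained in the board. -}

module Defs where

open import Data.Nat using (ℕ; _≤_)
open import Data.Integer using (ℤ; +_; _+_; -_; 0ℤ; 1ℤ; -1ℤ) renaming (_≤_ to _≤ℤ_; _<_ to _<ℤ_)
open import Data.Fin using (Fin; zero; suc)
open import Data.Bool using (Bool; true)
open import Data.Vec using (Vec; lookup)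
open import Data.Product using (_×_; _,_; ∃; Σ)
open import Data.Sum using (_⊎_)
open import Relation.Binary.PropositionalEquality using (_≡_)

-- A cell of the square grid, identified by the integer coordinates of
-- its lower-left corner.
Cell : Set
Cell = ℤ × ℤ

offset : Fin 4 → Cell
offset zero                   = (1ℤ , 0ℤ)
offset (suc zero)             = (-1ℤ , 0ℤ)
offset (suc (suc zero))       = (0ℤ , 1ℤ)
offset (suc (suc (suc zero))) = (0ℤ , -1ℤ)

_⊕_ : Cell → Cell → Cell
(a , b) ⊕ (c , d) = (a + c , b + d)

InBoard : ℕ → Cell → Set
InBoard n (a , b) = (+ 0 ≤ℤ a × a <ℤ + n) × (+ 0 ≤ℤ b × b <ℤ + n)

-- The X-pentomino centred at c: c together with its four neighbours.
InX : Cell → Cell → Set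
InX c d = d ≡ c ⊎ ∃ λ (i : Fin 4) → d ≡ c ⊕ offset i

-- x(n) ≤ k witnessed: k X-pentominoes (anywhere in the grid) whose
-- union contains the n×n board.
XCover : ℕ → ℕ → Set
XCover n k = Σ (Fin k → Cell) λ centre →
  ∀ d → InBoard n d → ∃ λ (i : Fin k) → InX (centre i) d

-- A fragment: a cell together with a nonempty subset of its four
-- neighbours (the subset given by a Boolean vector indexed by directions).
record Fragment : Set where
  constructor fragment
  field
    centre   : Cell
    dirs     : Vec Bool 4
    nonempty : ∃ λ (i : Fin 4) → lookup dirs i ≡ true

InFrag : Fragment → Cell → Set
InFrag (fragment c s _) d =
  d ≡ c ⊎ ∃ λ (i : Fin 4) → (lookup s i ≡ true) × (d ≡ c ⊕ offset i)

FragPartition : ℕ → ℕ → Set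
FragPartition n k = Σ (Fin k → Fragment) λ F →
    (∀ i d → InFrag (F i) d → InBoard n d)
  × (∀ d → InBoard n d → ∃ λ (i : Fin k) → InFrag (F i) d)
  × (∀ i j d → InFrag (F i) d → InFrag (F j) d → i ≡ j)

IsMinimum : (ℕ → Set) → ℕ → Set
IsMinimum P k = P k × (∀ m → P m → k ≤ m)

-- Both numbers equal the domination number γ of the n×n grid graph.  An
-- X-pentomino whose centre lies off the board can be recentred at the
-- nearest board cell without losing any board cell it covers, so x(n) = γ.
-- The centres of a fragment partition dominate the board, so f(n) ≥ γ.
-- Conversely, in a graph without isolated vertices a minimum dominating set
-- admits an assignment of every vertex to a dominating centre in which each
-- centre receives a vertex other than itself: while some centre i is alone,
-- take a neighbour u of it; if u's owner keeps another vertex, hand u to i,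
-- and otherwise moving that owner's centre to u and deleting i leaves a
-- smaller dominating set.  The classes of such an assignment are fragments.
module Submission where

open import Defs
open import Data.Nat using (ℕ; _≤_)
open import Data.Product using (∃; _×_)

open import Data.Nat as ℕ using (zero; suc; _<_; z≤n; s≤s)
import Data.Nat.Properties as ℕP
open import Data.Nat.Induction using (<-rec)
open import Data.Integer as ℤ using (ℤ; +_; -[1+_]; 0ℤ; 1ℤ; -1ℤ; +≤+; +<+)
import Data.Integer.Properties as ℤP
open import Data.Fin as Fin using (Fin; toℕ; fromℕ<; inject₁; punchIn; punchOut)
import Data.Fin.Properties as FinP
open import Data.Vec using (Vec; []; _∷_; lookup; tabulate)
open import Data.Vec.Properties using (lookup∘tabulate)
open import Data.Vec.Functional using (updateAt)
open import Data.Vec.Functional.Properties using (updateAt-updates; updateAt-minimal)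
open import Data.List using (List; []; _∷_; allFin)
open import Data.List.Relation.Unary.All as All using (All; []; _∷_)
open import Data.List.Membership.Propositional.Properties using (∈-allFin)
open import Data.Product using (Σ; _,_; proj₁; proj₂)
open import Data.Product.Properties using (≡-dec)
open import Data.Sum using (_⊎_; inj₁; inj₂)
open import Data.Bool using (Bool; true)
open import Data.Empty using (⊥; ⊥-elim)
open import Function using (_∘_; const)
open import Relation.Nullary using (Dec; yes; no; ¬_; ¬?; does)
open import Relation.Nullary.Decidable
  using (map′; _×-dec_; _⊎-dec_; decidable-stable; dec-true)
open import Relation.Unary using (Decidable)
open import Relation.Binary.Definitions using (DecidableEquality)
open import Relation.Binary.PropositionalEquality

least-satisfying : {P : ℕ → Set} → Decidable P → ∀ {N} → P N → ∃ (IsMinimum P)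
least-satisfying {P} P? {N} = <-rec (λ N → P N → ∃ (IsMinimum P)) search N
  where
  search : ∀ N → (∀ {m} → m < N → P m → ∃ (IsMinimum P)) → P N → ∃ (IsMinimum P)
  search N smaller pN with ℕP.anyUpTo? P? N
  ... | yes (m , m<N , pm) = smaller m<N pm
  ... | no none = N , pN , λ m pm → ℕP.≮⇒≥ (λ m<N → none (m , m<N , pm))

minimum-transfer : ∀ {P Q : ℕ → Set} {k} →
  IsMinimum P k → Q k → (∀ {m} → Q m → P m) → IsMinimum Q k
minimum-transfer (_ , least) qk q⇒p = qk , λ m qm → least m (q⇒p qm)

Exhaustible : Set → Set₁
Exhaustible A = ∀ {P : A → Set} → Decidable P → Dec (∃ P)

module _ {A : Set} (∃? : Exhaustible A) where

  all? : {P : A → Set} → Decidable P → Dec (∀ x → P x)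
  all? P? with ∃? (¬? ∘ P?)
  ... | yes (x , ¬px) = no λ all → ¬px (all x)
  ... | no none = yes λ x → decidable-stable (P? x) (λ ¬px → none (x , ¬px))

  Vec-exhaustible : ∀ k → Exhaustible (Vec A k)
  Vec-exhaustible zero P? = map′ ([] ,_) (λ { ([] , p) → p }) (P? [])
  Vec-exhaustible (suc k) P? =
    map′ (λ { (x , xs , p) → x ∷ xs , p }) (λ { (x ∷ xs , p) → x , xs , p })
         (∃? λ x → Vec-exhaustible k (P? ∘ (x ∷_)))

×-exhaustible : ∀ {A B : Set} → Exhaustible A → Exhaustible B → Exhaustible (A × B)
×-exhaustible ∃A? ∃B? P? =
  map′ (λ { (a , b , p) → (a , b) , p }) (λ { ((a , b) , p) → a , b , p })
       (∃A? λ a → ∃B? λ b → P? (a , b))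

does-true : ∀ {P : Set} (P? : Dec P) → does P? ≡ true → P
does-true (yes p) _ = p
does-true (no _) ()

module _ {A B : Set} (_≟_ : DecidableEquality A) where

  update : (A → B) → A → B → A → B
  update f a b x with x ≟ a
  ... | yes _ = b
  ... | no _ = f x

  update-≢ : ∀ {f a b x} → x ≢ a → update f a b x ≡ f x
  update-≢ {a = a} {x = x} x≢a with x ≟ a
  ... | yes x≡a = ⊥-elim (x≢a x≡a)
  ... | no _ = refl

  update-≡ : ∀ {f a b} → update f a b a ≡ b
  update-≡ {a = a} with a ≟ a
  ... | yes _ = refl
  ... | no a≢a = ⊥-elim (a≢a refl)

module Domination
  {V : Set} (_≟_ : DecidableEquality V) (∃? : Exhaustible V)
  (_∼_ : V → V → Set) (_∼?_ : ∀ u v → Dec (u ∼ v))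
  (∼-refl : ∀ {v} → v ∼ v) (∼-sym : ∀ {u v} → u ∼ v → v ∼ u)
  where

  Dominates : ∀ {k} → (Fin k → V) → Set
  Dominates D = ∀ v → ∃ λ i → D i ∼ v

  Dominating : ℕ → Set
  Dominating k = Σ (Fin k → V) Dominates

  dominating? : ∀ k → Dec (Dominating k)
  dominating? k =
    map′ (λ { (D , dom) → lookup D , dom }) (λ { (D , dom) → tabulate D , retabulate D dom })
         (Vec-exhaustible ∃? k λ D → all? ∃? λ v → FinP.any? λ i → lookup D i ∼? v)
    where
    retabulate : ∀ D → Dominates D → Dominates (lookup (tabulate D))
    retabulate D dom v with dom v
    ... | i , Di∼v = i , subst (_∼ v) (sym (lookup∘tabulate D i)) Di∼v

  minimum-dominating : ∀ {m} → Dominating m → ∃ (IsMinimum Dominating)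
  minimum-dominating = least-satisfying dominating?

  dominating-without : ∀ {k} (D : Fin (suc k) → V) (i : Fin (suc k)) →
    (∀ v → ∃ λ l → l ≢ i × D l ∼ v) → Dominating k
  dominating-without D i dom = D ∘ punchIn i , λ v → reindex (dom v)
    where
    reindex : ∀ {v} → ∃ (λ l → l ≢ i × D l ∼ v) → ∃ λ l → D (punchIn i l) ∼ v
    reindex {v} (l , l≢i , Dl∼v) =
      punchOut (l≢i ∘ sym) , subst (_∼ v) (cong D (sym (FinP.punchIn-punchOut (l≢i ∘ sym)))) Dl∼v

  record Assignment {k} (D : Fin k → V) : Set where
    field
      owner        : V → Fin k
      owner-centre : ∀ i → owner (D i) ≡ i
      centre-owner : ∀ v → D (owner v) ∼ v

  module _ {k} {D : Fin k → V} (A : Assignment D) where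
    open Assignment A

    HasLeaf : Fin k → Set
    HasLeaf i = ∃ λ v → owner v ≡ i × v ≢ D i

    hasLeaf? : ∀ i → Dec (HasLeaf i)
    hasLeaf? i = ∃? λ v → (owner v FinP.≟ i) ×-dec ¬? (v ≟ D i)

    Lonely : Fin k → Set
    Lonely i = ∀ v → owner v ≡ i → v ≡ D i

    ¬hasLeaf⇒lonely : ∀ {i} → ¬ HasLeaf i → Lonely i
    ¬hasLeaf⇒lonely {i} no-leaf v ov≡i =
      decidable-stable (v ≟ D i) λ v≢Di → no-leaf (v , ov≡i , v≢Di)

    reassign : ∀ {i u} → (∀ j → D j ≢ u) → D i ∼ u → Assignment D
    reassign {i} {u} u-not-centre Di∼u = record
      { owner        = update _≟_ owner u i
      ; owner-centre = λ j → trans (update-≢ _≟_ (u-not-centre j)) (owner-centre j)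
      ; centre-owner = covers
      }
      where
      covers : ∀ v → D (update _≟_ owner u i v) ∼ v
      covers v with v ≟ u
      ... | yes refl = Di∼u
      ... | no _ = centre-owner v

  record StarPartition (k : ℕ) : Set where
    field
      centre     : Fin k → V
      assignment : Assignment centre
      leafy      : ∀ i → HasLeaf assignment i

  module Minimal
    (no-isolated : ∀ v → ∃ λ u → v ∼ u × u ≢ v)
    {k} (no-smaller : ¬ Dominating k) (D : Fin (suc k) → V) (dom : Dominates D)
    where

    centres-injective : ∀ {i j} → D i ≡ D j → i ≡ j
    centres-injective {i} {j} Di≡Dj =
      decidable-stable (i FinP.≟ j) λ i≢j → no-smaller (dominating-without D i (redirect i≢j))
      where
      redirect : i ≢ j → ∀ v → ∃ λ l → l ≢ i × D l ∼ v
      redirect i≢j v with dom v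
      ... | l , Dl∼v with l FinP.≟ i
      ...   | yes refl = j , i≢j ∘ sym , subst (_∼ v) Di≡Dj Dl∼v
      ...   | no l≢i = l , l≢i , Dl∼v

    initial : Assignment D
    initial = record
      { owner        = λ v → choose v (centre? v)
      ; owner-centre = λ i → choose-centre i (centre? (D i))
      ; centre-owner = λ v → choose-covers v (centre? v)
      }
      where
      centre? : ∀ v → Dec (∃ λ i → D i ≡ v)
      centre? v = FinP.any? λ i → D i ≟ v
      choose : ∀ v → Dec (∃ λ i → D i ≡ v) → Fin (suc k)
      choose v (yes (i , _)) = i
      choose v (no _) = proj₁ (dom v)
      choose-centre : ∀ i c → choose (D i) c ≡ i
      choose-centre i (yes (j , Dj≡Di)) = centres-injective Dj≡Di
      choose-centre i (no not-centre) = ⊥-elim (not-centre (i , refl))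
      choose-covers : ∀ v c → D (choose v c) ∼ v
      choose-covers v (yes (i , refl)) = ∼-refl
      choose-covers v (no _) = proj₂ (dom v)

    module _ (A : Assignment D) where
      open Assignment A

      -- Moving centre j to u and deleting centre i: impossible by minimality.
      relocate : ∀ {i j u} → j ≢ i → ¬ HasLeaf A i → D i ∼ u →
        (∀ v → owner v ≡ j → u ∼ v) → ⊥
      relocate {i} {j} {u} j≢i no-leaf Di∼u owned-by-j =
        no-smaller (dominating-without D′ i covers)
        where
        D′ : Fin (suc k) → V
        D′ = updateAt D j (const u)
        D′j : D′ j ≡ u
        D′j = updateAt-updates j D
        covers : ∀ v → ∃ λ l → l ≢ i × D′ l ∼ v
        covers v with owner v FinP.≟ i | owner v FinP.≟ j
        ... | yes ov≡i | _ =
          j , j≢i , subst₂ _∼_ (sym D′j) (sym (¬hasLeaf⇒lonely A no-leaf v ov≡i)) (∼-sym Di∼u)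
        ... | no _ | yes ov≡j = j , j≢i , subst (_∼ v) (sym D′j) (owned-by-j v ov≡j)
        ... | no ov≢i | no ov≢j = owner v , ov≢i ,
          subst (_∼ v) (sym (updateAt-minimal (owner v) j D ov≢j)) (centre-owner v)

      gain-leaf : ∀ i → ¬ HasLeaf A i →
        Σ (Assignment D) λ A′ → (∀ j → HasLeaf A j → HasLeaf A′ j) × HasLeaf A′ i
      gain-leaf i no-leaf with no-isolated (D i)
      ... | u , Di∼u , u≢Di with FinP.any? (λ j → D j ≟ u)
      ...   | yes (j , Dj≡u) = ⊥-elim (relocate j≢i no-leaf Di∼u owned-by-j)
        where
        j≢i : j ≢ i
        j≢i j≡i = u≢Di (trans (sym Dj≡u) (cong D j≡i))
        owned-by-j : ∀ v → owner v ≡ j → u ∼ v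
        owned-by-j v refl = subst (_∼ v) Dj≡u (centre-owner v)
      ...   | no u-not-centre
              with ∃? (λ w → (owner w FinP.≟ owner u) ×-dec ¬? (w ≟ D (owner u)) ×-dec ¬? (w ≟ u))
      ...     | yes (w , ow≡ou , w≢Dou , w≢u) = A′ , keeps-leaves , u , update-≡ _≟_ , u≢Di
        where
        A′ = reassign A (λ j Dj≡u → u-not-centre (j , Dj≡u)) Di∼u
        keeps-leaves : ∀ j → HasLeaf A j → HasLeaf A′ j
        keeps-leaves .(owner v) (v , refl , v≢Dov) with v ≟ u
        ... | yes refl = w , trans (update-≢ _≟_ w≢u) ow≡ou , w≢Dou
        ... | no v≢u = v , update-≢ _≟_ v≢u , v≢Dov
      ...     | no no-other-leaf = ⊥-elim (relocate ou≢i no-leaf Di∼u owned-by-ou)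
        where
        ou≢i : owner u ≢ i
        ou≢i ou≡i = u≢Di (¬hasLeaf⇒lonely A no-leaf u ou≡i)
        owned-by-ou : ∀ v → owner v ≡ owner u → u ∼ v
        owned-by-ou v ov≡ou with v ≟ D (owner u) | v ≟ u
        ... | yes refl | _ = ∼-sym (centre-owner u)
        ... | no _ | yes refl = ∼-refl
        ... | no v≢Dou | no v≢u = ⊥-elim (no-other-leaf (v , ov≡ou , v≢Dou , v≢u))

    leafy-on : (is : List (Fin (suc k))) → Σ (Assignment D) λ A → All (HasLeaf A) is
    leafy-on [] = initial , []
    leafy-on (i ∷ is) with leafy-on is
    ... | A , leaves with hasLeaf? A i
    ...   | yes leaf = A , leaf ∷ leaves
    ...   | no no-leaf with gain-leaf A i no-leaf
    ...     | A′ , keeps-leaves , leaf = A′ , leaf ∷ All.map (keeps-leaves _) leaves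

    star-partition : StarPartition (suc k)
    star-partition with leafy-on (allFin (suc k))
    ... | A , leaves = record
      { centre = D ; assignment = A ; leafy = λ i → All.lookup leaves (∈-allFin i) }

  minimum-star-partition : (∀ v → ∃ λ u → v ∼ u × u ≢ v) →
    ∀ {k} → IsMinimum Dominating k → StarPartition k
  minimum-star-partition _ {zero} ((D , dom) , _) = record
    { centre     = D
    ; assignment = record
      { owner = proj₁ ∘ dom ; owner-centre = λ () ; centre-owner = proj₂ ∘ dom }
    ; leafy      = λ ()
    }
  minimum-star-partition no-isolated {suc k} ((D , dom) , least) =
    Minimal.star-partition no-isolated (λ γ → ℕP.<-irrefl refl (least k γ)) D dom

_≟ᶜ_ : DecidableEquality Cell
_≟ᶜ_ = ≡-dec ℤ._≟_ ℤ._≟_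

InX? : ∀ c d → Dec (InX c d)
InX? c d = (d ≟ᶜ c) ⊎-dec FinP.any? (λ i → d ≟ᶜ (c ⊕ offset i))

opposite : Fin 4 → Fin 4
opposite Fin.zero                               = Fin.suc Fin.zero
opposite (Fin.suc Fin.zero)                     = Fin.zero
opposite (Fin.suc (Fin.suc Fin.zero))           = Fin.suc (Fin.suc (Fin.suc Fin.zero))
opposite (Fin.suc (Fin.suc (Fin.suc Fin.zero))) = Fin.suc (Fin.suc Fin.zero)

offset-opposite : ∀ i → offset i ⊕ offset (opposite i) ≡ (0ℤ , 0ℤ)
offset-opposite Fin.zero                               = refl
offset-opposite (Fin.suc Fin.zero)                     = refl
offset-opposite (Fin.suc (Fin.suc Fin.zero))           = refl
offset-opposite (Fin.suc (Fin.suc (Fin.suc Fin.zero))) = refl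

⊕-offset-opposite : ∀ c i → (c ⊕ offset i) ⊕ offset (opposite i) ≡ c
⊕-offset-opposite (x , y) i =
  cong₂ _,_ (+-cancel x (cong proj₁ (offset-opposite i)))
            (+-cancel y (cong proj₂ (offset-opposite i)))
  where
  +-cancel : ∀ x {a b} → a ℤ.+ b ≡ 0ℤ → (x ℤ.+ a) ℤ.+ b ≡ x
  +-cancel x {a} {b} a+b≡0 = begin
    (x ℤ.+ a) ℤ.+ b ≡⟨ ℤP.+-assoc x a b ⟩
    x ℤ.+ (a ℤ.+ b) ≡⟨ cong (λ t → x ℤ.+ t) a+b≡0 ⟩
    x ℤ.+ 0ℤ        ≡⟨ ℤP.+-identityʳ x ⟩
    x               ∎
    where open ≡-Reasoning

InX-sym : ∀ {c d} → InX c d → InX d c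
InX-sym (inj₁ d≡c) = inj₁ (sym d≡c)
InX-sym {c} (inj₂ (i , refl)) = inj₂ (opposite i , sym (⊕-offset-opposite c i))

InRange : ℕ → ℤ → Set
InRange n x = + 0 ℤ.≤ x × x ℤ.< + n

clamp : ∀ {m} → ℤ → Fin (suc m)
clamp {m} (+ k) = fromℕ< (s≤s (ℕP.m⊓n≤n k m))
clamp -[1+ _ ] = Fin.zero

clamp-inRange : ∀ {m x} → InRange (suc m) x → + toℕ (clamp {m} x) ≡ x
clamp-inRange {m} {+ k} (_ , +<+ (s≤s k≤m)) =
  cong +_ (trans (FinP.toℕ-fromℕ< _) (ℕP.m≤n⇒m⊓n≡m k≤m))

Pinned : ℕ → ℤ → ℤ → Set
Pinned m x y = + toℕ (clamp {m} x) ≡ x ⊎ + toℕ (clamp {m} x) ≡ y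

pinned-+0 : ∀ {m} x → InRange (suc m) (x ℤ.+ 0ℤ) → Pinned m x (x ℤ.+ 0ℤ)
pinned-+0 x r = inj₁ (clamp-inRange (subst (InRange _) (ℤP.+-identityʳ x) r))

pinned-+1 : ∀ {m} x → InRange (suc m) (x ℤ.+ 1ℤ) → Pinned m x (x ℤ.+ 1ℤ)
pinned-+1 (+ k) (_ , +<+ k+1<n) =
  inj₁ (clamp-inRange (+≤+ z≤n , +<+ (ℕP.≤-trans (s≤s (ℕP.m≤m+n k 1)) k+1<n)))
pinned-+1 -[1+ zero ] _ = inj₂ refl
pinned-+1 -[1+ suc _ ] (() , _)

pinned--1 : ∀ {m} x → InRange (suc m) (x ℤ.+ -1ℤ) → Pinned m x (x ℤ.+ -1ℤ)
pinned--1 (+ zero) (() , _)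
pinned--1 {m} (+ suc k) (_ , +<+ (s≤s k≤m)) with suc k ℕP.≤? m
... | yes k<m = inj₁ (cong +_ (trans (FinP.toℕ-fromℕ< _) (ℕP.m≤n⇒m⊓n≡m k<m)))
... | no k≮m = inj₂ (cong +_ (trans (FinP.toℕ-fromℕ< _) (trans (ℕP.m≥n⇒m⊓n≡n m≤1+k) m≡k)))
  where
  m≤k : m ≤ k
  m≤k = ℕP.≤-pred (ℕP.≰⇒> k≮m)
  m≤1+k : m ≤ suc k
  m≤1+k = ℕP.m≤n⇒m≤1+n m≤k
  m≡k : m ≡ k
  m≡k = ℕP.≤-antisym m≤k k≤m
pinned--1 -[1+ _ ] (() , _)

clampCell : ∀ {m} → Cell → Fin (suc m) × Fin (suc m)
clampCell (x , y) = clamp x , clamp y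

toCell : ∀ {n} → Fin n × Fin n → Cell
toCell (a , b) = + toℕ a , + toℕ b

clampCell-inBoard : ∀ {m d} → InBoard (suc m) d → toCell (clampCell {m} d) ≡ d
clampCell-inBoard (rx , ry) = cong₂ _,_ (clamp-inRange rx) (clamp-inRange ry)

-- A pentomino sliding one step along an axis keeps the other coordinate, so
-- the clamped centre is the old centre or the covered cell itself.
pinned-InX : ∀ {m x₁ x₂ y₁ y₂} → InX (x₁ , x₂) (y₁ , y₂) → x₁ ≡ y₁ ⊎ x₂ ≡ y₂ →
  Pinned m x₁ y₁ → Pinned m x₂ y₂ → InX (toCell (clampCell {m} (x₁ , x₂))) (y₁ , y₂)
pinned-InX h _ (inj₁ p) (inj₁ q) = subst (λ c → InX c _) (sym (cong₂ _,_ p q)) h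
pinned-InX h _ (inj₂ p) (inj₂ q) = inj₁ (sym (cong₂ _,_ p q))
pinned-InX h (inj₁ e) (inj₁ p) (inj₂ q) = inj₁ (sym (cong₂ _,_ (trans p e) q))
pinned-InX h (inj₂ e) (inj₁ p) (inj₂ q) = subst (λ c → InX c _) (sym (cong₂ _,_ p (trans q (sym e)))) h
pinned-InX h (inj₁ e) (inj₂ p) (inj₁ q) = subst (λ c → InX c _) (sym (cong₂ _,_ (trans p (sym e)) q)) h
pinned-InX h (inj₂ e) (inj₂ p) (inj₁ q) = inj₁ (sym (cong₂ _,_ p (trans q e)))

InX-clampCell : ∀ {m} c d → InBoard (suc m) d → InX c d → InX (toCell (clampCell {m} c)) d
InX-clampCell c d board (inj₁ refl) = subst (λ c → InX c d) (sym (clampCell-inBoard board)) (inj₁ refl)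
InX-clampCell (x , y) _ (rx , ry) h@(inj₂ (Fin.zero , refl)) =
  pinned-InX h (inj₂ (sym (ℤP.+-identityʳ y))) (pinned-+1 x rx) (pinned-+0 y ry)
InX-clampCell (x , y) _ (rx , ry) h@(inj₂ (Fin.suc Fin.zero , refl)) =
  pinned-InX h (inj₂ (sym (ℤP.+-identityʳ y))) (pinned--1 x rx) (pinned-+0 y ry)
InX-clampCell (x , y) _ (rx , ry) h@(inj₂ (Fin.suc (Fin.suc Fin.zero) , refl)) =
  pinned-InX h (inj₁ (sym (ℤP.+-identityʳ x))) (pinned-+0 x rx) (pinned-+1 y ry)
InX-clampCell (x , y) _ (rx , ry) h@(inj₂ (Fin.suc (Fin.suc (Fin.suc Fin.zero)) , refl)) =
  pinned-InX h (inj₁ (sym (ℤP.+-identityʳ x))) (pinned-+0 x rx) (pinned--1 y ry)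

module Grid (n′ : ℕ) where

  n : ℕ
  n = suc (suc n′)

  Square : Set
  Square = Fin n × Fin n

  _∼_ : Square → Square → Set
  p ∼ q = InX (toCell p) (toCell q)

  open Domination (≡-dec FinP._≟_ FinP._≟_) (×-exhaustible FinP.any? FinP.any?)
    _∼_ (λ p q → InX? (toCell p) (toCell q)) (inj₁ refl) InX-sym
    public

  toCell-injective : ∀ {p q : Square} → toCell p ≡ toCell q → p ≡ q
  toCell-injective e = cong₂ _,_ (FinP.toℕ-injective (ℤP.+-injective (cong proj₁ e)))
                                 (FinP.toℕ-injective (ℤP.+-injective (cong proj₂ e)))

  toCell-inBoard : ∀ (p : Square) → InBoard n (toCell p)
  toCell-inBoard (a , b) = (+≤+ z≤n , +<+ (FinP.toℕ<n a)) , (+≤+ z≤n , +<+ (FinP.toℕ<n b))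

  has-distinct-neighbour : ∀ p → ∃ λ q → p ∼ q × q ≢ p
  has-distinct-neighbour (Fin.zero , b) =
    (Fin.suc Fin.zero , b) , inj₂ (Fin.zero , cong (+ 1 ,_) (sym (ℤP.+-identityʳ _))) , λ ()
  has-distinct-neighbour (Fin.suc a , b) =
    (inject₁ a , b) ,
    inj₂ (Fin.suc Fin.zero , cong₂ _,_ (cong +_ (FinP.toℕ-inject₁ a)) (sym (ℤP.+-identityʳ _))) ,
    λ e → ℕP.<-irrefl (trans (sym (FinP.toℕ-inject₁ a)) (cong (toℕ ∘ proj₁) e)) (ℕP.n<1+n (toℕ a))

  all-squares-dominate : Dominating (n ℕ.* n)
  all-squares-dominate = Fin.remQuot n , λ { (a , b) →
    Fin.combine a b , subst (_∼ (a , b)) (sym (FinP.remQuot-combine a b)) (inj₁ refl) }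

  dominating⇒xCover : ∀ {k} → Dominating k → XCover n k
  dominating⇒xCover (D , dom) = toCell ∘ D , λ d board →
    proj₁ (dom (clampCell d)) , subst (InX _) (clampCell-inBoard board) (proj₂ (dom (clampCell d)))

  xCover⇒dominating : ∀ {k} → XCover n k → Dominating k
  xCover⇒dominating (centre , covers) = clampCell ∘ centre , λ p →
    let (i , h) = covers (toCell p) (toCell-inBoard p)
    in i , InX-clampCell (centre i) (toCell p) (toCell-inBoard p) h

  fragPartition⇒dominating : ∀ {k} → FragPartition n k → Dominating k
  fragPartition⇒dominating (F , inside , covers , _) = clampCell ∘ centre , λ p →
    let (i , p∈Fi) = covers (toCell p) (toCell-inBoard p)
    in i , subst (λ c → InX c (toCell p)) (sym (clampCell-inBoard (inside i _ (centre∈ (F i)))))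
                 (InFrag⇒InX (F i) p∈Fi)
    where
    centre = Fragment.centre ∘ F
    centre∈ : ∀ f → InFrag f (Fragment.centre f)
    centre∈ (fragment _ _ _) = inj₁ refl
    InFrag⇒InX : ∀ f {d} → InFrag f d → InX (Fragment.centre f) d
    InFrag⇒InX (fragment _ _ _) (inj₁ d≡c) = inj₁ d≡c
    InFrag⇒InX (fragment _ _ _) (inj₂ (i , _ , d≡c+i)) = inj₂ (i , d≡c+i)

  module _ {k} (S : StarPartition k) where
    open StarPartition S
    open Assignment assignment

    Owned : Fin k → Cell → Set
    Owned i d = ∃ λ p → toCell p ≡ d × owner p ≡ i

    owned? : ∀ i d → Dec (Owned i d)
    owned? i d = ×-exhaustible FinP.any? FinP.any? λ p → (toCell p ≟ᶜ d) ×-dec (owner p FinP.≟ i)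

    arm : Fin k → Fin 4 → Bool
    arm i j = does (owned? i (toCell (centre i) ⊕ offset j))

    arms : Fin k → Vec Bool 4
    arms i = tabulate (arm i)

    owned⇒arm : ∀ i j → Owned i (toCell (centre i) ⊕ offset j) → lookup (arms i) j ≡ true
    owned⇒arm i j o = trans (lookup∘tabulate (arm i) j) (dec-true (owned? i _) o)

    arm⇒owned : ∀ i j → lookup (arms i) j ≡ true → Owned i (toCell (centre i) ⊕ offset j)
    arm⇒owned i j t =
      does-true (owned? i _) (trans (sym (lookup∘tabulate (arm i) j)) t)

    some-arm : ∀ i → ∃ λ j → lookup (arms i) j ≡ true
    some-arm i with leafy i
    ... | v , refl , v≢centre with centre-owner v
    ...   | inj₁ e = ⊥-elim (v≢centre (toCell-injective e))
    ...   | inj₂ (j , e) = j , owned⇒arm (owner v) j (v , e , refl)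

    star : Fin k → Fragment
    star i = fragment (toCell (centre i)) (arms i) (some-arm i)

    InFrag⇒owned : ∀ i {d} → InFrag (star i) d → Owned i d
    InFrag⇒owned i (inj₁ refl) = centre i , refl , owner-centre i
    InFrag⇒owned i (inj₂ (j , t , refl)) = arm⇒owned i j t

    starPartition⇒fragPartition : FragPartition n k
    starPartition⇒fragPartition = star , inside , covers , disjoint
      where
      inside : ∀ i d → InFrag (star i) d → InBoard n d
      inside i d d∈ with InFrag⇒owned i d∈
      ... | p , refl , _ = toCell-inBoard p
      covers-square : ∀ p → ∃ λ i → InFrag (star i) (toCell p)
      covers-square p with centre-owner p
      ... | inj₁ e = owner p , inj₁ e
      ... | inj₂ (j , e) = owner p , inj₂ (j , owned⇒arm (owner p) j (p , e , refl) , e)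
      covers : ∀ d → InBoard n d → ∃ λ i → InFrag (star i) d
      covers d board =
        subst (λ d → ∃ λ i → InFrag (star i) d) (clampCell-inBoard board) (covers-square (clampCell d))
      disjoint : ∀ i j d → InFrag (star i) d → InFrag (star j) d → i ≡ j
      disjoint i j d d∈i d∈j with InFrag⇒owned i d∈i | InFrag⇒owned j d∈j
      ... | p , refl , refl | q , e , refl = cong owner (toCell-injective (sym e))

mainTheorem8 : ∀ (n : ℕ) → 2 ≤ n →
    ∃ λ (k : ℕ) → IsMinimum (XCover n) k × IsMinimum (FragPartition n) k
mainTheorem8 zero ()
mainTheorem8 (suc zero) (s≤s ())
mainTheorem8 (suc (suc n′)) _ with minimum-dominating all-squares-dominate
  where open Grid n′
... | k , minimum@(γ , _) = k
  , minimum-transfer minimum (dominating⇒xCover γ) xCover⇒dominating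
  , minimum-transfer minimum
      (starPartition⇒fragPartition (minimum-star-partition has-distinct-neighbour minimum))
      fragPartition⇒dominating
  where open Grid n′
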